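{- For any signature $S$ and any set $X$ of positive integers, the map $\mathrm{tlt}(X):T(S)\to T(S)$ is a closure operator of the poset $(T(S),\preceq)$, i.e. (1) $t\preceq \mathrm{tlt}(X)(t)$ for all $t$; (2) $t\preceq t'$ implies $\mathrm{tlt}(X)(t)\preceq\mathrm{tlt}(X)(t')$; (3) $\mathrm{tlt}(X)(\mathrm{tlt}(X)(t))=\mathrm{tlt}(X)(t)$ for all $t$.
   Context: A signature is a set $S$ with an arity map $|\cdot|:S\to\mathbb N$. An $S$-term is either the leaf $\ell$ or a tuple $s\,t_1\cdots t_{|s|}$ with $s\in S$ and $t_1,\dots,t_{|s|}$ $S$-terms (an ordered rooted tree whose internal nodes having $k$ children are decorated by elements of arity $k$); $T(S)$ is the set of $S$-terms. The preorder traversal of $s\,t_1\cdots t_k$ visits the root, then $t_1,\dots,t_k$ from left to right recursively. Internal nodes of $t$ are numbered $1,\dots,\deg t$ in preorder and identified with these numbers; $\mathrm{dc}(t)$ is the word of decorations of the internal nodes in this order. Children of a node (leaves included) are numbered $1,2,\dots$ from left to right. The parent edge of a non-root internal node $i$ is $(\mathrm{pa}(i),\mathrm{lp}(i),i)$ where $i$ is the $\mathrm{lp}(i)$-th child of $\mathrm{pa}(i)$; for the root, by convention $\mathrm{pa}(1)=1$, $\mathrm{lp}(1)=0$. The connection word is $\mathrm{cnc}(t)(i)=\mathrm{pa}(i)+1-2^{\mathrm{lp}(i)-a}$, $a$ being the arity of the decoration of $\mathrm{pa}(i)$. The easterly wind order: $t_1\preceq t_2$ iff $\mathrm{dc}(t_1)=\mathrm{dc}(t_2)$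 and $\mathrm{cnc}(t_1)(i)\le\mathrm{cnc}(t_2)(i)$ for all $i$. For a set $X$ of positive integers, $\mathrm{tlt}(X)(t)$ is the $S$-term obtained from $t$ by rearranging, for every internal node $i\in X$, the children of $i$ so that the non-leaf children keep their original relative order and precede all children that are leaves. -}

module Defs where

open import Data.Nat using (ℕ; zero; suc; _+_; _∸_)
open import Data.Bool using (Bool; true; false; if_then_else_)
open import Data.List using (List; []; _∷_; _++_)
open import Data.Vec using (Vec; []; _∷_; _∷ʳ_)
open import Data.Integer using (+_)
open import Data.Rational using (ℚ; 1ℚ; ½; _/_) renaming (_+_ to _+ℚ_; _-_ to _-ℚ_; _*_ to _*ℚ_; _≤_ to _≤ℚ_)
open import Data.List.Relation.Binary.Pointwise using (Pointwise)
open import Data.Product using (_×_)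
open import Relation.Binary.PropositionalEquality using (_≡_)

pow2neg : ℕ → ℚ
pow2neg zero    = 1ℚ
pow2neg (suc k) = ½ *ℚ pow2neg k

-- the value pa + 1 - 2^{lp - a}  (lp ≤ a always holds where it is used)
cncVal : (pa lp a : ℕ) → ℚ
cncVal pa lp a = ((+ pa / 1) +ℚ 1ℚ) -ℚ pow2neg (a ∸ lp)

module Sig (S : Set) (ar : S → ℕ) where

  data Term : Set where
    leaf : Term
    node : (s : S) → Vec Term (ar s) → Term

  mutual
    deg : Term → ℕ
    deg leaf        = 0
    deg (node s ts) = suc (degs ts)

    degs : ∀ {k} → Vec Term k → ℕ
    degs []       = 0
    degs (t ∷ ts) = deg t + degs ts

  mutual
    dc : Term → List S
    dc leaf        = []
    dc (node s ts) = s ∷ dcs ts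

    dcs : ∀ {k} → Vec Term k → List S
    dcs []       = []
    dcs (t ∷ ts) = dc t ++ dcs ts

  -- connection word entries of the internal nodes of the children of a
  -- node numbered p with arity a; the current child is the pos-th child,
  -- and its root (if internal) gets preorder number n.
  mutual
    cncSub : (p a pos n : ℕ) → Term → List ℚ
    cncSub p a pos n leaf        = []
    cncSub p a pos n (node s ts) = cncVal p pos a ∷ cncChildren n (ar s) 1 (suc n) ts

    cncChildren : ∀ {k} → (p a pos n : ℕ) → Vec Term k → List ℚ
    cncChildren p a pos n []       = []
    cncChildren p a pos n (t ∷ ts) =
      cncSub p a pos n t ++ cncChildren p a (suc pos) (n + deg t) ts

  -- connection word; root: pa(1) = 1, lp(1) = 0, a = arity of root decoration
  cnc : Term → List ℚ
  cnc leaf        = []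
  cnc (node s ts) = cncSub 1 (ar s) 0 1 (node s ts)

  _⪯_ : Term → Term → Set
  t₁ ⪯ t₂ = (dc t₁ ≡ dc t₂) × Pointwise _≤ℚ_ (cnc t₁) (cnc t₂)

  leavesLast : ∀ {k} → Vec Term k → Vec Term k
  leavesLast []                 = []
  leavesLast (leaf ∷ ts)        = leavesLast ts ∷ʳ leaf
  leavesLast (node s us ∷ ts)   = node s us ∷ leavesLast ts

  -- tlt(X), X given by its characteristic function on ℕ (only positive
  -- arguments matter: internal nodes are numbered from 1).
  -- tltAt X n t : t's root (if internal) carries number n in the whole tree.
  mutual
    tltAt : (ℕ → Bool) → ℕ → Term → Term
    tltAt X n leaf        = leaf
    tltAt X n (node s ts) =
      node s (if X n then leavesLast (tltVec X (suc n) ts) else tltVec X (suc n) ts)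

    tltVec : ∀ {k} → (ℕ → Bool) → ℕ → Vec Term k → Vec Term k
    tltVec X n []       = []
    tltVec X n (t ∷ ts) = tltAt X n t ∷ tltVec X (n + deg t) ts

  tlt : (ℕ → Bool) → Term → Term
  tlt X t = tltAt X 1 t

-- Flatten a term into the preorder list of the parent edges of its internal nodes.  The
-- connection word is the image of this list under (parent, position, arity) ↦
-- parent + 1 - 2^(position - arity), a value in [parent, parent + 1) that decreases with the
-- position.  Leaves carry no preorder number, so tlt(X) changes neither the numbering nor the
-- parents: it only replaces the position of each child of a node of X by its rank among the
-- internal children, which is smaller; hence tlt(X) is extensive.  For monotonicity, the only
-- case to check is that of two edges at the same place with the same parent q ∈ X: in preorder
-- every node before a child of q lies below q or is not after q, so an earlier sibling in the
-- larger term is, at the same place, an earlier sibling in the smaller one, and ranks compare.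
-- Idempotence holds because tlt(X) commutes with moving leaves to the end.
module Submission where

open import Defs
open import Data.Bool using (Bool; true; false; if_then_else_)
open import Data.Empty using (⊥-elim)
open import Data.Integer as ℤ using (+≤+)
import Data.Integer.Properties as ℤ
open import Data.List using (List; []; _∷_; _++_; map; length; drop; [_])
open import Data.List.Properties using (map-++; length-++; ++-assoc; ++-identityʳ; ∷-injective)
open import Data.List.Relation.Binary.Pointwise as Pointwise using (Pointwise; []; _∷_)
open import Data.List.Relation.Binary.Pointwise.Properties using (Pointwise-length)
open import Data.List.Relation.Unary.All as All using (All; []; _∷_)
open import Data.List.Relation.Unary.All.Properties using (++⁺)
open import Data.Nat
  using (ℕ; zero; suc; _+_; _∸_; _≤_; _<_; z≤n; s≤s; _≤′_; ≤′-refl; ≤′-step; _≤?_; _≟_)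
import Data.Nat.Properties as ℕ
import Data.Nat.Coprimality as Coprime
open import Data.Product using (_×_; _,_; proj₁; proj₂)
open import Data.Rational using (ℚ; mkℚ; 0ℚ; 1ℚ; ½; -_; _/_; *≤*; nonNegative)
  renaming (_+_ to _+ℚ_; _-_ to _-ℚ_; _*_ to _*ℚ_; _≤_ to _≤ℚ_; _<_ to _<ℚ_)
import Data.Rational.Properties as ℚ
open import Data.Rational.Unnormalised using (*≡*)
import Data.Rational.Unnormalised.Properties as ℚᵘ
open import Data.Sum using (_⊎_; inj₁; inj₂; [_,_]′; map₂)
open import Data.Unit using (⊤; tt)
open import Data.Vec using (Vec; []; _∷_; _∷ʳ_)
open import Function using (_∘_; _on_)
open import Relation.Nullary using (yes; no)
open import Relation.Binary.PropositionalEquality as ≡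
  using (_≡_; _≢_; refl; cong; cong₂; subst; subst₂; module ≡-Reasoning)

fromℕ : ℕ → ℚ
fromℕ n = ℤ.+ n / 1

fromℕ≡mkℚ : ∀ n → fromℕ n ≡ mkℚ (ℤ.+ n) 0 (Coprime.sym (Coprime.1-coprimeTo n))
fromℕ≡mkℚ n = ℚ.normalize-coprime (Coprime.sym (Coprime.1-coprimeTo n))

fromℕ-mono-≤ : ∀ {m n} → m ≤ n → fromℕ m ≤ℚ fromℕ n
fromℕ-mono-≤ {m} {n} m≤n rewrite fromℕ≡mkℚ m | fromℕ≡mkℚ n =
  *≤* (subst₂ ℤ._≤_ (≡.sym (ℤ.*-identityʳ (ℤ.+ m))) (≡.sym (ℤ.*-identityʳ (ℤ.+ n)))
                    (+≤+ m≤n))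

fromℕ-suc : ∀ n → fromℕ n +ℚ 1ℚ ≡ fromℕ (suc n)
fromℕ-suc n rewrite fromℕ≡mkℚ n | fromℕ≡mkℚ (suc n) =
  ℚ.toℚᵘ-injective (ℚᵘ.≃-trans (ℚ.toℚᵘ-homo-+ (mkℚ (ℤ.+ n) 0 (Coprime.sym (Coprime.1-coprimeTo n))) 1ℚ)
    (*≡* (cong (ℤ._* ℤ.+ 1) (≡.trans (cong (ℤ._+ ℤ.+ 1) (ℤ.*-identityʳ (ℤ.+ n))) (ℤ.+-comm (ℤ.+ n) (ℤ.+ 1))))))

pow2neg-positive : ∀ k → 0ℚ <ℚ pow2neg k
pow2neg-positive zero    = ℚ.positive⁻¹ 1ℚ
pow2neg-positive (suc k) =
  subst (_<ℚ ½ *ℚ pow2neg k) (ℚ.*-zeroʳ ½) (ℚ.*-monoʳ-<-pos ½ (pow2neg-positive k))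

pow2neg-suc-≤ : ∀ k → pow2neg (suc k) ≤ℚ pow2neg k
pow2neg-suc-≤ k = subst (½ *ℚ pow2neg k ≤ℚ_) (ℚ.*-identityˡ (pow2neg k))
  (ℚ.*-monoʳ-≤-nonNeg (pow2neg k) {{nonNegative (ℚ.<⇒≤ (pow2neg-positive k))}} {½} {1ℚ}
                       (ℚ.≤ᵇ⇒≤ _))

pow2neg-antitone : ∀ {k k′} → k ≤ k′ → pow2neg k′ ≤ℚ pow2neg k
pow2neg-antitone = antitone′ ∘ ℕ.≤⇒≤′
  where
  antitone′ : ∀ {k k′} → k ≤′ k′ → pow2neg k′ ≤ℚ pow2neg k
  antitone′ ≤′-refl             = ℚ.≤-refl
  antitone′ (≤′-step {n} k≤k′) = ℚ.≤-trans (pow2neg-suc-≤ n) (antitone′ k≤k′)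

fromℕ≤cncVal : ∀ p l a → fromℕ p ≤ℚ cncVal p l a
fromℕ≤cncVal p l a = begin
  fromℕ p                           ≡⟨ +-1-1 (fromℕ p) ⟨
  fromℕ p +ℚ 1ℚ -ℚ pow2neg 0        ≤⟨ ℚ.+-monoʳ-≤ (fromℕ p +ℚ 1ℚ)
                                         (ℚ.neg-antimono-≤ (pow2neg-antitone {k′ = a ∸ l} z≤n)) ⟩
  fromℕ p +ℚ 1ℚ -ℚ pow2neg (a ∸ l)  ∎
  where
  open ℚ.≤-Reasoning
  +-1-1 : ∀ x → x +ℚ 1ℚ -ℚ 1ℚ ≡ x
  +-1-1 x = ≡.trans (ℚ.+-assoc x 1ℚ (- 1ℚ))
                    (≡.trans (cong (λ y → x +ℚ y) (ℚ.+-inverseʳ 1ℚ)) (ℚ.+-identityʳ x))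

cncVal<fromℕ-suc : ∀ p l a → cncVal p l a <ℚ fromℕ (suc p)
cncVal<fromℕ-suc p l a = begin-strict
  fromℕ p +ℚ 1ℚ -ℚ pow2neg (a ∸ l)  <⟨ ℚ.+-monoʳ-< (fromℕ p +ℚ 1ℚ)
                                         (ℚ.neg-antimono-< (pow2neg-positive (a ∸ l))) ⟩
  fromℕ p +ℚ 1ℚ +ℚ - 0ℚ             ≡⟨ ℚ.+-identityʳ (fromℕ p +ℚ 1ℚ) ⟩
  fromℕ p +ℚ 1ℚ                     ≡⟨ fromℕ-suc p ⟩
  fromℕ (suc p)                     ∎
  where open ℚ.≤-Reasoning

cncVal-antitone : ∀ p a {l l′} → l ≤ l′ → cncVal p l′ a ≤ℚ cncVal p l a
cncVal-antitone p a l≤l′ =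
  ℚ.+-monoʳ-≤ (fromℕ p +ℚ 1ℚ) (ℚ.neg-antimono-≤ (pow2neg-antitone (ℕ.∸-monoʳ-≤ a l≤l′)))

record Edge : Set where
  constructor edge
  field
    parent index position arity rank : ℕ

open Edge

cncEntry : Edge → ℚ
cncEntry e = cncVal (parent e) (position e) (arity e)

cncEntry-mono-< : ∀ e e′ → parent e < parent e′ → cncEntry e ≤ℚ cncEntry e′
cncEntry-mono-< (edge p _ l a _) (edge p′ _ l′ a′ _) p<p′ = ℚ.<⇒≤ (begin-strict
  cncVal p l a     <⟨ cncVal<fromℕ-suc p l a ⟩
  fromℕ (suc p)    ≤⟨ fromℕ-mono-≤ p<p′ ⟩
  fromℕ p′         ≤⟨ fromℕ≤cncVal p′ l′ a′ ⟩
  cncVal p′ l′ a′  ∎)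
  where open ℚ.≤-Reasoning

cncEntry-cancel-≤ : ∀ e e′ → cncEntry e ≤ℚ cncEntry e′ → parent e ≤ parent e′
cncEntry-cancel-≤ (edge p _ l a _) (edge p′ _ l′ a′ _) le with p ≤? p′
... | yes p≤p′ = p≤p′
... | no p≰p′  = ⊥-elim (ℚ.<-irrefl refl (begin-strict
  cncVal p l a     ≤⟨ le ⟩
  cncVal p′ l′ a′  <⟨ cncVal<fromℕ-suc p′ l′ a′ ⟩
  fromℕ (suc p′)   ≤⟨ fromℕ-mono-≤ (ℕ.≰⇒> p≰p′) ⟩
  fromℕ p          ≤⟨ fromℕ≤cncVal p l a ⟩
  cncVal p l a     ∎))
  where open ℚ.≤-Reasoning

tiltEdge : (ℕ → Bool) → Edge → Edge
tiltEdge X e = record e { position = if X (parent e) then rank e else position e }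

tiltEdge-unmarked : ∀ X e → X (parent e) ≡ false → tiltEdge X e ≡ e
tiltEdge-unmarked X (edge p i l a r) Xp = cong (λ b → edge p i (if b then r else l) a r) Xp

tiltEdge-marked : ∀ X e → X (parent e) ≡ true → tiltEdge X e ≡ record e { position = rank e }
tiltEdge-marked X (edge p i l a r) Xp = cong (λ b → edge p i (if b then r else l) a r) Xp

cncEntry-≤-tiltEdge : ∀ X e → rank e ≤ position e → cncEntry e ≤ℚ cncEntry (tiltEdge X e)
cncEntry-≤-tiltEdge X (edge p _ l a r) r≤l with X p
... | true  = cncVal-antitone p a r≤l
... | false = ℚ.≤-refl

map-cncEntry-≤-tilt : ∀ X L → All (λ e → rank e ≤ position e) L →
                      Pointwise _≤ℚ_ (map cncEntry L) (map cncEntry (map (tiltEdge X) L))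
map-cncEntry-≤-tilt X []      []         = []
map-cncEntry-≤-tilt X (e ∷ L) (r≤l ∷ rs) = cncEntry-≤-tiltEdge X e r≤l ∷ map-cncEntry-≤-tilt X L rs

countParent : ℕ → List Edge → ℕ
countParent q []      = 0
countParent q (e ∷ L) with parent e ≟ q
... | yes _ = suc (countParent q L)
... | no _  = countParent q L

countParent-++ : ∀ q A B → countParent q (A ++ B) ≡ countParent q A + countParent q B
countParent-++ q []      B = refl
countParent-++ q (e ∷ A) B with parent e ≟ q
... | yes _ = cong suc (countParent-++ q A B)
... | no _  = countParent-++ q A B

countParent-none : ∀ q L → All (λ e → parent e ≢ q) L → countParent q L ≡ 0
countParent-none q []      []       = refl
countParent-none q (e ∷ L) (e≢ ∷ L≢) with parent e ≟ q
... | yes e≡ = ⊥-elim (e≢ e≡)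
... | no _   = countParent-none q L L≢

-- In preorder, a node coming before a child of q lies below q or is not after q.
BelowOrBefore : ℕ → Edge → Set
BelowOrBefore q j = q ≤ parent j ⊎ index j ≤ q

-- e may follow the edges Pre in the preorder edge list of a term; the numbering starts at 2
-- because the root has no genuine parent edge.
record ValidAfter (Pre : List Edge) (e : Edge) : Set where
  field
    earlier-belowOrBefore : All (BelowOrBefore (parent e)) Pre
    index≡                : index e ≡ 2 + length Pre
    rank≡                 : rank e ≡ suc (countParent (parent e) Pre)
    parent<index          : parent e < index e

open ValidAfter

ValidContinuation : List Edge → List Edge → Set
ValidContinuation Pre []      = ⊤
ValidContinuation Pre (e ∷ L) = ValidAfter Pre e × ValidContinuation (Pre ++ [ e ]) L

ValidContinuation-++ : ∀ Pre A B → ValidContinuation Pre A → ValidContinuation (Pre ++ A) B →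
                       ValidContinuation Pre (A ++ B)
ValidContinuation-++ Pre []      B _         vB = subst (λ P → ValidContinuation P B) (++-identityʳ Pre) vB
ValidContinuation-++ Pre (e ∷ A) B (ve , vA) vB = ve , ValidContinuation-++ (Pre ++ [ e ]) A B vA
  (subst (λ P → ValidContinuation P B) (≡.sym (++-assoc Pre [ e ] A)) vB)

-- j and j′ sit at the same place of the edge lists of two terms with t ⪯ t′.
record Paired (j j′ : Edge) : Set where
  constructor paired
  field
    parent-≤       : parent j ≤ parent j′
    parent′<index′ : parent j′ < index j′
    same-index     : index j ≡ index j′

Paired-sameParent : ∀ {q j j′} → Paired j j′ → BelowOrBefore q j → parent j′ ≡ q → parent j ≡ q
Paired-sameParent (paired pj≤pj′ _ _) (inj₁ q≤pj) refl = ℕ.≤-antisym pj≤pj′ q≤pj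
Paired-sameParent {j′ = j′} (paired _ pj′<ij′ ij≡ij′) (inj₂ ij≤q) refl =
  ⊥-elim (ℕ.<-irrefl refl (ℕ.<-≤-trans pj′<ij′ (subst (_≤ parent j′) ij≡ij′ ij≤q)))

countParent-antitone : ∀ q {Pre Pre′} → Pointwise Paired Pre Pre′ → All (BelowOrBefore q) Pre →
                       countParent q Pre′ ≤ countParent q Pre
countParent-antitone q [] [] = z≤n
countParent-antitone q {j ∷ Pre} {j′ ∷ Pre′} (jj′ ∷ pp) (b ∷ bs) with parent j′ ≟ q | parent j ≟ q
... | yes j′≡q | yes _   = s≤s (countParent-antitone q pp bs)
... | yes j′≡q | no j≢q  = ⊥-elim (j≢q (Paired-sameParent jj′ b j′≡q))
... | no _     | yes _   = ℕ.m≤n⇒m≤1+n (countParent-antitone q pp bs)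
... | no _     | no _    = countParent-antitone q pp bs

HasArity : (ℕ → ℕ) → Edge → Set
HasArity α e = arity e ≡ α (parent e)

tiltEdge-mono : ∀ X α {Pre Pre′ e e′} → ValidAfter Pre e → ValidAfter Pre′ e′ →
                Pointwise Paired Pre Pre′ → HasArity α e → HasArity α e′ → cncEntry e ≤ℚ cncEntry e′ →
                cncEntry (tiltEdge X e) ≤ℚ cncEntry (tiltEdge X e′)
tiltEdge-mono X α {e = edge p i l _ r} {edge p′ i′ l′ _ r′} v v′ pp refl refl le
  with ℕ.m≤n⇒m<n∨m≡n (cncEntry-cancel-≤ (edge p i l (α p) r) (edge p′ i′ l′ (α p′) r′) le)
... | inj₁ p<p′ =
  cncEntry-mono-< (tiltEdge X (edge p i l (α p) r)) (tiltEdge X (edge p′ i′ l′ (α p′) r′)) p<p′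
... | inj₂ refl with X p
...   | false = le
...   | true  = cncVal-antitone p (α p) (subst₂ _≤_ (≡.sym (rank≡ v′)) (≡.sym (rank≡ v))
                  (s≤s (countParent-antitone p pp (earlier-belowOrBefore v))))

tilt-mono : ∀ X α {Pre Pre′} L L′ → ValidContinuation Pre L → ValidContinuation Pre′ L′ →
            Pointwise Paired Pre Pre′ → All (HasArity α) L → All (HasArity α) L′ →
            Pointwise (_≤ℚ_ on cncEntry) L L′ → Pointwise (_≤ℚ_ on (cncEntry ∘ tiltEdge X)) L L′
tilt-mono X α [] [] _ _ _ _ _ [] = []
tilt-mono X α (e ∷ L) (e′ ∷ L′) (v , vs) (v′ , vs′) pp (αe ∷ αs) (αe′ ∷ αs′) (le ∷ les) =
  tiltEdge-mono X α v v′ pp αe αe′ le ∷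
  tilt-mono X α L L′ vs vs′ (Pointwise.++⁺ pp (e~e′ ∷ [])) αs αs′ les
  where
  e~e′ : Paired e e′
  e~e′ = paired (cncEntry-cancel-≤ e e′ le) (parent<index v′)
           (≡.trans (index≡ v) (≡.trans (cong (2 +_) (Pointwise-length pp)) (≡.sym (index≡ v′))))

drop-suc : ∀ {A : Set} m (D : List A) {x xs} → drop m D ≡ x ∷ xs → drop (suc m) D ≡ xs
drop-suc zero    (y ∷ D) refl = refl
drop-suc (suc m) (y ∷ D) eq   = drop-suc m D eq

drop-+-++ : ∀ {A : Set} m (D : List A) xs ys → drop m D ≡ xs ++ ys → drop (m + length xs) D ≡ ys
drop-+-++ m D []       ys eq = ≡.trans (cong (λ i → drop i D) (ℕ.+-identityʳ m)) eq
drop-+-++ m D (x ∷ xs) ys eq =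
  ≡.trans (cong (λ i → drop i D) (ℕ.+-suc m (length xs))) (drop-+-++ (suc m) D xs ys (drop-suc m D eq))

module _ (S : Set) (ar : S → ℕ) where
  open Sig S ar

  nextRank : Term → ℕ → ℕ
  nextRank leaf       r = r
  nextRank (node _ _) r = suc r

  -- cncSub and cncChildren, keeping the whole parent edge; rk is the rank of t among the
  -- internal children of p.
  mutual
    edgesSub : (p a pos rk n : ℕ) → Term → List Edge
    edgesSub p a pos rk n leaf        = []
    edgesSub p a pos rk n (node s ts) = edge p n pos a rk ∷ edgesChildren n (ar s) 1 1 (suc n) ts

    edgesChildren : ∀ {k} (p a pos rk n : ℕ) → Vec Term k → List Edge
    edgesChildren p a pos rk n []       = []
    edgesChildren p a pos rk n (t ∷ ts) =
      edgesSub p a pos rk n t ++ edgesChildren p a (suc pos) (nextRank t rk) (n + deg t) ts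

  edgesChildrenRanked : ∀ {k} (p a rk n : ℕ) → Vec Term k → List Edge
  edgesChildrenRanked p a rk n []       = []
  edgesChildrenRanked p a rk n (t ∷ ts) =
    edgesSub p a rk rk n t ++ edgesChildrenRanked p a (nextRank t rk) (n + deg t) ts

  mutual
    cncSub≡edgesSub : ∀ p a pos rk n t → cncSub p a pos n t ≡ map cncEntry (edgesSub p a pos rk n t)
    cncSub≡edgesSub p a pos rk n leaf        = refl
    cncSub≡edgesSub p a pos rk n (node s ts) =
      cong (cncVal p pos a ∷_) (cncChildren≡edgesChildren n (ar s) 1 1 (suc n) ts)

    cncChildren≡edgesChildren : ∀ {k} p a pos rk n (ts : Vec Term k) →
                                cncChildren p a pos n ts ≡ map cncEntry (edgesChildren p a pos rk n ts)
    cncChildren≡edgesChildren p a pos rk n []       = refl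
    cncChildren≡edgesChildren p a pos rk n (t ∷ ts) = ≡.trans
      (cong₂ _++_ (cncSub≡edgesSub p a pos rk n t)
                  (cncChildren≡edgesChildren p a (suc pos) (nextRank t rk) (n + deg t) ts))
      (≡.sym (map-++ cncEntry (edgesSub p a pos rk n t) _))

  cnc-node : ∀ s ts →
             cnc (node s ts) ≡ cncVal 1 0 (ar s) ∷ map cncEntry (edgesChildren 1 (ar s) 1 1 2 ts)
  cnc-node s ts = cong (cncVal 1 0 (ar s) ∷_) (cncChildren≡edgesChildren 1 (ar s) 1 1 2 ts)

  mutual
    deg≡length-dc : ∀ t → deg t ≡ length (dc t)
    deg≡length-dc leaf        = refl
    deg≡length-dc (node s ts) = cong suc (degs≡length-dcs ts)

    degs≡length-dcs : ∀ {k} (ts : Vec Term k) → degs ts ≡ length (dcs ts)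
    degs≡length-dcs []       = refl
    degs≡length-dcs (t ∷ ts) =
      ≡.trans (cong₂ _+_ (deg≡length-dc t) (degs≡length-dcs ts)) (≡.sym (length-++ (dc t)))

  dcs-∷ʳ-leaf : ∀ {k} (ts : Vec Term k) → dcs (ts ∷ʳ leaf) ≡ dcs ts
  dcs-∷ʳ-leaf []       = refl
  dcs-∷ʳ-leaf (t ∷ ts) = cong (dc t ++_) (dcs-∷ʳ-leaf ts)

  dcs-leavesLast : ∀ {k} (ts : Vec Term k) → dcs (leavesLast ts) ≡ dcs ts
  dcs-leavesLast []               = refl
  dcs-leavesLast (leaf ∷ ts)      = ≡.trans (dcs-∷ʳ-leaf (leavesLast ts)) (dcs-leavesLast ts)
  dcs-leavesLast (node s us ∷ ts) = cong ((s ∷ dcs us) ++_) (dcs-leavesLast ts)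

  mutual
    dc-tltAt : ∀ X n t → dc (tltAt X n t) ≡ dc t
    dc-tltAt X n leaf        = refl
    dc-tltAt X n (node s ts) with X n
    ... | true  = cong (s ∷_) (≡.trans (dcs-leavesLast (tltVec X (suc n) ts)) (dcs-tltVec X (suc n) ts))
    ... | false = cong (s ∷_) (dcs-tltVec X (suc n) ts)

    dcs-tltVec : ∀ {k} X n (ts : Vec Term k) → dcs (tltVec X n ts) ≡ dcs ts
    dcs-tltVec X n []       = refl
    dcs-tltVec X n (t ∷ ts) = cong₂ _++_ (dc-tltAt X n t) (dcs-tltVec X (n + deg t) ts)

  deg-tltAt : ∀ X n t → deg (tltAt X n t) ≡ deg t
  deg-tltAt X n t = begin
    deg (tltAt X n t)           ≡⟨ deg≡length-dc (tltAt X n t) ⟩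
    length (dc (tltAt X n t))   ≡⟨ cong length (dc-tltAt X n t) ⟩
    length (dc t)               ≡⟨ ≡.sym (deg≡length-dc t) ⟩
    deg t                       ∎
    where open ≡-Reasoning

  leavesLast-∷ʳ-leaf : ∀ {k} (ts : Vec Term k) → leavesLast (ts ∷ʳ leaf) ≡ leavesLast ts ∷ʳ leaf
  leavesLast-∷ʳ-leaf []               = refl
  leavesLast-∷ʳ-leaf (leaf ∷ ts)      = cong (_∷ʳ leaf) (leavesLast-∷ʳ-leaf ts)
  leavesLast-∷ʳ-leaf (node s us ∷ ts) = cong (node s us ∷_) (leavesLast-∷ʳ-leaf ts)

  leavesLast-idem : ∀ {k} (ts : Vec Term k) → leavesLast (leavesLast ts) ≡ leavesLast ts
  leavesLast-idem []               = refl
  leavesLast-idem (leaf ∷ ts)      =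
    ≡.trans (leavesLast-∷ʳ-leaf (leavesLast ts)) (cong (_∷ʳ leaf) (leavesLast-idem ts))
  leavesLast-idem (node s us ∷ ts) = cong (node s us ∷_) (leavesLast-idem ts)

  tltVec-∷ʳ-leaf : ∀ {k} X n (ts : Vec Term k) → tltVec X n (ts ∷ʳ leaf) ≡ tltVec X n ts ∷ʳ leaf
  tltVec-∷ʳ-leaf X n []       = refl
  tltVec-∷ʳ-leaf X n (t ∷ ts) = cong (tltAt X n t ∷_) (tltVec-∷ʳ-leaf X (n + deg t) ts)

  tltVec-leavesLast : ∀ {k} X n (ts : Vec Term k) →
                      tltVec X n (leavesLast ts) ≡ leavesLast (tltVec X n ts)
  tltVec-leavesLast X n []               = refl
  tltVec-leavesLast X n (leaf ∷ ts) rewrite ℕ.+-identityʳ n =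
    ≡.trans (tltVec-∷ʳ-leaf X n (leavesLast ts)) (cong (_∷ʳ leaf) (tltVec-leavesLast X n ts))
  tltVec-leavesLast X n (node s us ∷ ts) =
    cong (tltAt X n (node s us) ∷_) (tltVec-leavesLast X (n + deg (node s us)) ts)

  mutual
    tltAt-idem : ∀ X n t → tltAt X n (tltAt X n t) ≡ tltAt X n t
    tltAt-idem X n leaf        = refl
    tltAt-idem X n (node s ts) with X n
    ... | true  = cong (node s) (begin
      leavesLast (tltVec X (suc n) (leavesLast ts′))  ≡⟨ cong leavesLast (tltVec-leavesLast X (suc n) ts′) ⟩
      leavesLast (leavesLast (tltVec X (suc n) ts′))  ≡⟨ leavesLast-idem (tltVec X (suc n) ts′) ⟩
      leavesLast (tltVec X (suc n) ts′)               ≡⟨ cong leavesLast (tltVec-idem X (suc n) ts) ⟩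
      leavesLast ts′                                  ∎)
      where
      open ≡-Reasoning
      ts′ = tltVec X (suc n) ts
    ... | false = cong (node s) (tltVec-idem X (suc n) ts)

    tltVec-idem : ∀ {k} X n (ts : Vec Term k) → tltVec X n (tltVec X n ts) ≡ tltVec X n ts
    tltVec-idem X n []       = refl
    tltVec-idem X n (t ∷ ts) rewrite deg-tltAt X n t =
      cong₂ _∷_ (tltAt-idem X n t) (tltVec-idem X (n + deg t) ts)

  edgesChildren-∷ʳ-leaf : ∀ {k} p a pos rk n (ts : Vec Term k) →
                          edgesChildren p a pos rk n (ts ∷ʳ leaf) ≡ edgesChildren p a pos rk n ts
  edgesChildren-∷ʳ-leaf p a pos rk n []       = refl
  edgesChildren-∷ʳ-leaf p a pos rk n (t ∷ ts) =
    cong (edgesSub p a pos rk n t ++_) (edgesChildren-∷ʳ-leaf p a (suc pos) (nextRank t rk) (n + deg t) ts)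

  edgesChildren-leavesLast : ∀ {k} p a r n (ts : Vec Term k) →
                             edgesChildren p a r r n (leavesLast ts) ≡ edgesChildrenRanked p a r n ts
  edgesChildren-leavesLast p a r n []               = refl
  edgesChildren-leavesLast p a r n (leaf ∷ ts)      = begin
    edgesChildren p a r r n (leavesLast ts ∷ʳ leaf)  ≡⟨ edgesChildren-∷ʳ-leaf p a r r n (leavesLast ts) ⟩
    edgesChildren p a r r n (leavesLast ts)          ≡⟨ edgesChildren-leavesLast p a r n ts ⟩
    edgesChildrenRanked p a r n ts                   ≡⟨ cong (λ m → edgesChildrenRanked p a r m ts)
                                                             (ℕ.+-identityʳ n) ⟨
    edgesChildrenRanked p a r (n + 0) ts             ∎
    where open ≡-Reasoning
  edgesChildren-leavesLast p a r n (node s us ∷ ts) =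
    cong (edgesSub p a r r n (node s us) ++_) (edgesChildren-leavesLast p a (suc r) (n + deg (node s us)) ts)

  mutual
    edgesChildren-tltChildren : ∀ {k} X n a (ts : Vec Term k) →
      edgesChildren n a 1 1 (suc n) (if X n then leavesLast (tltVec X (suc n) ts) else tltVec X (suc n) ts)
        ≡ map (tiltEdge X) (edgesChildren n a 1 1 (suc n) ts)
    edgesChildren-tltChildren X n a ts with X n in Xn
    ... | true  = ≡.trans (edgesChildren-leavesLast n a 1 (suc n) (tltVec X (suc n) ts))
                          (edgesChildrenRanked-tltVec X n a 1 1 (suc n) ts Xn)
    ... | false = edgesChildren-tltVec X n a 1 1 (suc n) ts Xn

    edgesChildren-tltVec : ∀ {k} X p a pos rk n (ts : Vec Term k) → X p ≡ false →
      edgesChildren p a pos rk n (tltVec X n ts) ≡ map (tiltEdge X) (edgesChildren p a pos rk n ts)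
    edgesChildren-tltVec X p a pos rk n []               Xp = refl
    edgesChildren-tltVec X p a pos rk n (leaf ∷ ts)      Xp =
      edgesChildren-tltVec X p a (suc pos) rk (n + 0) ts Xp
    edgesChildren-tltVec X p a pos rk n (node s us ∷ ts) Xp
      rewrite deg-tltAt X n (node s us) =
      cong₂ _∷_ (≡.sym (tiltEdge-unmarked X (edge p n pos a rk) Xp)) (≡.trans
        (cong₂ _++_ (edgesChildren-tltChildren X n (ar s) us)
                    (edgesChildren-tltVec X p a (suc pos) (suc rk) (n + deg (node s us)) ts Xp))
        (≡.sym (map-++ (tiltEdge X) (edgesChildren n (ar s) 1 1 (suc n) us) _)))

    edgesChildrenRanked-tltVec : ∀ {k} X p a pos rk n (ts : Vec Term k) → X p ≡ true →
      edgesChildrenRanked p a rk n (tltVec X n ts) ≡ map (tiltEdge X) (edgesChildren p a pos rk n ts)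
    edgesChildrenRanked-tltVec X p a pos rk n []               Xp = refl
    edgesChildrenRanked-tltVec X p a pos rk n (leaf ∷ ts)      Xp =
      edgesChildrenRanked-tltVec X p a (suc pos) rk (n + 0) ts Xp
    edgesChildrenRanked-tltVec X p a pos rk n (node s us ∷ ts) Xp
      rewrite deg-tltAt X n (node s us) =
      cong₂ _∷_ (≡.sym (tiltEdge-marked X (edge p n pos a rk) Xp)) (≡.trans
        (cong₂ _++_ (edgesChildren-tltChildren X n (ar s) us)
                    (edgesChildrenRanked-tltVec X p a (suc pos) (suc rk) (n + deg (node s us)) ts Xp))
        (≡.sym (map-++ (tiltEdge X) (edgesChildren n (ar s) 1 1 (suc n) us) _)))

  cnc-tlt-node : ∀ X s ts → cnc (tlt X (node s ts)) ≡
                 cncVal 1 0 (ar s) ∷ map cncEntry (map (tiltEdge X) (edgesChildren 1 (ar s) 1 1 2 ts))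
  cnc-tlt-node X s ts = cong (cncVal 1 0 (ar s) ∷_) (≡.trans
    (cncChildren≡edgesChildren 1 (ar s) 1 1 2 (if X 1 then leavesLast (tltVec X 2 ts) else tltVec X 2 ts))
    (cong (map cncEntry) (edgesChildren-tltChildren X 1 (ar s) ts)))

  mutual
    edgesSub-rank≤position : ∀ p a pos rk n t → rk ≤ pos →
                             All (λ e → rank e ≤ position e) (edgesSub p a pos rk n t)
    edgesSub-rank≤position p a pos rk n leaf        _      = []
    edgesSub-rank≤position p a pos rk n (node s ts) rk≤pos =
      rk≤pos ∷ edgesChildren-rank≤position n (ar s) 1 1 (suc n) ts ℕ.≤-refl

    edgesChildren-rank≤position : ∀ {k} p a pos rk n (ts : Vec Term k) → rk ≤ pos →
                                  All (λ e → rank e ≤ position e) (edgesChildren p a pos rk n ts)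
    edgesChildren-rank≤position p a pos rk n []               _      = []
    edgesChildren-rank≤position p a pos rk n (leaf ∷ ts)      rk≤pos =
      edgesChildren-rank≤position p a (suc pos) rk (n + 0) ts (ℕ.m≤n⇒m≤1+n rk≤pos)
    edgesChildren-rank≤position p a pos rk n (node s us ∷ ts) rk≤pos =
      ++⁺ (edgesSub-rank≤position p a pos rk n (node s us) rk≤pos)
          (edgesChildren-rank≤position p a (suc pos) (suc rk) (n + deg (node s us)) ts (s≤s rk≤pos))

  ⪯-tlt : ∀ X t → t ⪯ tlt X t
  ⪯-tlt X leaf        = refl , []
  ⪯-tlt X (node s ts) rewrite cnc-node s ts | cnc-tlt-node X s ts =
    ≡.sym (dc-tltAt X 1 (node s ts)) ,
    ℚ.≤-refl ∷ map-cncEntry-≤-tilt X _ (edgesChildren-rank≤position 1 (ar s) 1 1 2 ts ℕ.≤-refl)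

  mutual
    length-edgesSub : ∀ p a pos rk n t → length (edgesSub p a pos rk n t) ≡ deg t
    length-edgesSub p a pos rk n leaf        = refl
    length-edgesSub p a pos rk n (node s us) = cong suc (length-edgesChildren n (ar s) 1 1 (suc n) us)

    length-edgesChildren : ∀ {k} p a pos rk n (ts : Vec Term k) →
                           length (edgesChildren p a pos rk n ts) ≡ degs ts
    length-edgesChildren p a pos rk n []       = refl
    length-edgesChildren p a pos rk n (t ∷ ts) = ≡.trans (length-++ (edgesSub p a pos rk n t))
      (cong₂ _+_ (length-edgesSub p a pos rk n t)
                 (length-edgesChildren p a (suc pos) (nextRank t rk) (n + deg t) ts))

  -- the edges of the subtree with k internal nodes whose root, numbered n, is a child of p
  record InSubtree (p n k : ℕ) (e : Edge) : Set where
    constructor inSubtree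
    field
      root-or-below : parent e ≡ p ⊎ n ≤ parent e
      parent<index  : parent e < index e
      index<        : index e < n + k

  mutual
    edgesSub-inSubtree : ∀ p a pos rk n t → p < n →
                         All (InSubtree p n (deg t)) (edgesSub p a pos rk n t)
    edgesSub-inSubtree p a pos rk n leaf        _   = []
    edgesSub-inSubtree p a pos rk n (node s us) p<n =
      inSubtree (inj₁ refl) p<n (ℕ.m<m+n n (s≤s z≤n)) ∷
      All.map widen (edgesChildren-inSubtree n (ar s) 1 1 (suc n) us (ℕ.n<1+n n))
      where
      widen : ∀ {e} → InSubtree n (suc n) (degs us) e → InSubtree p n (suc (degs us)) e
      widen {e} (inSubtree pa≡n⊎pa>n pa<i i<) =
        inSubtree (inj₂ ([ ℕ.≤-reflexive ∘ ≡.sym , ℕ.<⇒≤ ]′ pa≡n⊎pa>n)) pa<i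
                  (subst (index e <_) (≡.sym (ℕ.+-suc n (degs us))) i<)

    edgesChildren-inSubtree : ∀ {k} p a pos rk n (ts : Vec Term k) → p < n →
                              All (InSubtree p n (degs ts)) (edgesChildren p a pos rk n ts)
    edgesChildren-inSubtree p a pos rk n []       _   = []
    edgesChildren-inSubtree p a pos rk n (t ∷ ts) p<n =
      ++⁺ (All.map widenʳ (edgesSub-inSubtree p a pos rk n t p<n))
          (All.map shift (edgesChildren-inSubtree p a (suc pos) (nextRank t rk) (n + deg t) ts
                            (ℕ.<-≤-trans p<n (ℕ.m≤m+n n (deg t)))))
      where
      widenʳ : ∀ {e} → InSubtree p n (deg t) e → InSubtree p n (degs (t ∷ ts)) e
      widenʳ (inSubtree pa pa<i i<) =
        inSubtree pa pa<i (ℕ.<-≤-trans i< (ℕ.+-monoʳ-≤ n (ℕ.m≤m+n (deg t) (degs ts))))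
      shift : ∀ {e} → InSubtree p (n + deg t) (degs ts) e → InSubtree p n (degs (t ∷ ts)) e
      shift {e} (inSubtree pa pa<i i<) =
        inSubtree (map₂ (ℕ.m+n≤o⇒m≤o n) pa) pa<i
                  (subst (index e <_) (ℕ.+-assoc n (deg t) (degs ts)) i<)

  countParent-edgesSub : ∀ p a pos rk n t → p < n →
                         countParent p (edgesSub p a pos rk n t) ≡ nextRank t 0
  countParent-edgesSub p a pos rk n leaf        _   = refl
  countParent-edgesSub p a pos rk n (node s us) p<n with p ≟ p
  ... | no p≢p = ⊥-elim (p≢p refl)
  ... | yes _  = cong suc (countParent-none p _
                   (All.map notP (edgesChildren-inSubtree n (ar s) 1 1 (suc n) us (ℕ.n<1+n n))))
    where
    notP : ∀ {e} → InSubtree n (suc n) (degs us) e → parent e ≢ p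
    notP (inSubtree (inj₁ pa≡n) _ _) pa≡p = ℕ.<-irrefl (≡.trans (≡.sym pa≡p) pa≡n) p<n
    notP (inSubtree (inj₂ n<pa) _ _) pa≡p = ℕ.<-asym p<n (subst (n <_) pa≡p n<pa)

  nextRank-+ : ∀ t r → nextRank t r ≡ r + nextRank t 0
  nextRank-+ leaf       r = ≡.sym (ℕ.+-identityʳ r)
  nextRank-+ (node _ _) r = ≡.sym (ℕ.+-comm r 1)

  NumberedBefore : ℕ → Edge → Set
  NumberedBefore n j = parent j < n × index j < n

  mutual
    edgesSub-valid : ∀ {Pre} p a pos rk n t → All (NumberedBefore n) Pre →
                     All (BelowOrBefore p) Pre → rk ≡ suc (countParent p Pre) → p < n →
                     n ≡ 2 + length Pre → ValidContinuation Pre (edgesSub p a pos rk n t)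
    edgesSub-valid p a pos rk n leaf _ _ _ _ _ = tt
    edgesSub-valid {Pre} p a pos rk n (node s us) before bob rk≡ p<n n≡ =
      record { earlier-belowOrBefore = bob ; index≡ = n≡ ; rank≡ = rk≡ ; parent<index = p<n } ,
      edgesChildren-valid n (ar s) 1 1 (suc n) us before′ bob′ rank′ (ℕ.n<1+n n) n≡′
      where
      e = edge p n pos a rk
      before′ : All (NumberedBefore (suc n)) (Pre ++ [ e ])
      before′ = ++⁺ (All.map (λ (pa<n , i<n) → ℕ.m<n⇒m<1+n pa<n , ℕ.m<n⇒m<1+n i<n) before)
                    ((ℕ.m<n⇒m<1+n p<n , ℕ.n<1+n n) ∷ [])
      bob′ : All (BelowOrBefore n) (Pre ++ [ e ])
      bob′ = ++⁺ (All.map (inj₂ ∘ ℕ.<⇒≤ ∘ proj₂) before) (inj₂ ℕ.≤-refl ∷ [])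
      rank′ : 1 ≡ suc (countParent n (Pre ++ [ e ]))
      rank′ = cong suc (≡.sym (countParent-none n (Pre ++ [ e ])
                (++⁺ (All.map (ℕ.<⇒≢ ∘ proj₁) before) (ℕ.<⇒≢ p<n ∷ []))))
      n≡′ : suc n ≡ 2 + length (Pre ++ [ e ])
      n≡′ = begin
        suc n                       ≡⟨ cong suc n≡ ⟩
        2 + suc (length Pre)        ≡⟨ cong (2 +_) (ℕ.+-comm 1 (length Pre)) ⟩
        2 + (length Pre + 1)        ≡⟨ cong (2 +_) (length-++ Pre) ⟨
        2 + length (Pre ++ [ e ])   ∎
        where open ≡-Reasoning

    edgesChildren-valid : ∀ {k Pre} p a pos rk n (ts : Vec Term k) → All (NumberedBefore n) Pre →
                          All (BelowOrBefore p) Pre → rk ≡ suc (countParent p Pre) → p < n →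
                          n ≡ 2 + length Pre → ValidContinuation Pre (edgesChildren p a pos rk n ts)
    edgesChildren-valid p a pos rk n [] _ _ _ _ _ = tt
    edgesChildren-valid {Pre = Pre} p a pos rk n (t ∷ ts) before bob rk≡ p<n n≡ =
      ValidContinuation-++ Pre F _ (edgesSub-valid p a pos rk n t before bob rk≡ p<n n≡)
        (edgesChildren-valid p a (suc pos) (nextRank t rk) (n + deg t) ts
                             before′ bob′ rank′ (ℕ.<-≤-trans p<n n≤n+k) n≡′)
      where
      F = edgesSub p a pos rk n t
      n≤n+k = ℕ.m≤m+n n (deg t)
      inF = edgesSub-inSubtree p a pos rk n t p<n
      before′ : All (NumberedBefore (n + deg t)) (Pre ++ F)
      before′ = ++⁺ (All.map (λ (pa<n , i<n) → ℕ.<-≤-trans pa<n n≤n+k , ℕ.<-≤-trans i<n n≤n+k) before)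
                    (All.map (λ (inSubtree _ pa<i i<) → ℕ.<-trans pa<i i< , i<) inF)
      bob′ : All (BelowOrBefore p) (Pre ++ F)
      bob′ = ++⁺ bob (All.map (λ (inSubtree pa _ _) →
                                 inj₁ ([ ℕ.≤-reflexive ∘ ≡.sym , ℕ.≤-trans (ℕ.<⇒≤ p<n) ]′ pa)) inF)
      count-F : nextRank t 0 ≡ countParent p F
      count-F = ≡.sym (countParent-edgesSub p a pos rk n t p<n)
      rank′ : nextRank t rk ≡ suc (countParent p (Pre ++ F))
      rank′ = begin
        nextRank t rk                              ≡⟨ nextRank-+ t rk ⟩
        rk + nextRank t 0                          ≡⟨ cong₂ _+_ rk≡ count-F ⟩
        suc (countParent p Pre + countParent p F)  ≡⟨ cong suc (countParent-++ p Pre F) ⟨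
        suc (countParent p (Pre ++ F))             ∎
        where open ≡-Reasoning
      n≡′ : n + deg t ≡ 2 + length (Pre ++ F)
      n≡′ = begin
        n + deg t                    ≡⟨ cong₂ _+_ n≡ (≡.sym (length-edgesSub p a pos rk n t)) ⟩
        2 + length Pre + length F    ≡⟨ cong (2 +_) (length-++ Pre) ⟨
        2 + length (Pre ++ F)        ∎
        where open ≡-Reasoning

  headArity : List S → ℕ
  headArity []      = 0
  headArity (s ∷ _) = ar s

  -- nodes are numbered from 1: the decoration of node suc m is the head of drop m D
  arityAt : List S → ℕ → ℕ
  arityAt D zero    = 0
  arityAt D (suc m) = headArity (drop m D)

  mutual
    edgesSub-hasArity : ∀ D p a pos rk m t R → a ≡ arityAt D p → drop m D ≡ dc t ++ R →
                        All (HasArity (arityAt D)) (edgesSub p a pos rk (suc m) t)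
    edgesSub-hasArity D p a pos rk m leaf        R _  _  = []
    edgesSub-hasArity D p a pos rk m (node s us) R a≡ D≡ =
      a≡ ∷ edgesChildren-hasArity D (suc m) (ar s) 1 1 (suc m) us R
             (≡.sym (cong headArity D≡)) (drop-suc m D D≡)

    edgesChildren-hasArity : ∀ {k} D p a pos rk m (ts : Vec Term k) R → a ≡ arityAt D p →
                             drop m D ≡ dcs ts ++ R →
                             All (HasArity (arityAt D)) (edgesChildren p a pos rk (suc m) ts)
    edgesChildren-hasArity D p a pos rk m []       R _  _  = []
    edgesChildren-hasArity D p a pos rk m (t ∷ ts) R a≡ D≡ =
      ++⁺ (edgesSub-hasArity D p a pos rk m t (dcs ts ++ R) a≡ D≡′)
          (edgesChildren-hasArity D p a (suc pos) (nextRank t rk) (m + deg t) ts R a≡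
            (subst (λ i → drop (m + i) D ≡ dcs ts ++ R) (≡.sym (deg≡length-dc t))
                   (drop-+-++ m D (dc t) (dcs ts ++ R) D≡′)))
      where
      D≡′ : drop m D ≡ dc t ++ (dcs ts ++ R)
      D≡′ = ≡.trans D≡ (++-assoc (dc t) (dcs ts) R)

  edges-valid : ∀ {k} a (ts : Vec Term k) → ValidContinuation [] (edgesChildren 1 a 1 1 2 ts)
  edges-valid a ts = edgesChildren-valid 1 a 1 1 2 ts [] [] refl (s≤s (s≤s z≤n)) refl

  edges-hasArity : ∀ {D} s ts → D ≡ dc (node s ts) →
                   All (HasArity (arityAt D)) (edgesChildren 1 (ar s) 1 1 2 ts)
  edges-hasArity s ts refl =
    edgesChildren-hasArity _ 1 (ar s) 1 1 1 ts [] refl (≡.sym (++-identityʳ (dcs ts)))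

  tlt-mono : ∀ X t t′ → t ⪯ t′ → tlt X t ⪯ tlt X t′
  tlt-mono X leaf        leaf          _          = refl , []
  tlt-mono X leaf        (node s ts)   (() , _)
  tlt-mono X (node s ts) leaf          (() , _)
  tlt-mono X (node s ts) (node s′ ts′) (dc≡ , cnc≤) with ∷-injective dc≡
  ... | refl , _
    rewrite cnc-node s ts | cnc-node s ts′ | cnc-tlt-node X s ts | cnc-tlt-node X s ts′
    with cnc≤
  ... | _ ∷ edges≤ =
    ≡.trans (dc-tltAt X 1 (node s ts)) (≡.trans dc≡ (≡.sym (dc-tltAt X 1 (node s ts′)))) ,
    ℚ.≤-refl ∷ Pointwise.map⁺ cncEntry cncEntry (Pointwise.map⁺ (tiltEdge X) (tiltEdge X)
      (tilt-mono X (arityAt (dc (node s ts))) _ _ (edges-valid (ar s) ts) (edges-valid (ar s) ts′) []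
                 (edges-hasArity s ts refl) (edges-hasArity s ts′ dc≡)
                 (Pointwise.map⁻ cncEntry cncEntry edges≤)))

  tlt-idem : ∀ X t → tlt X (tlt X t) ≡ tlt X t
  tlt-idem X = tltAt-idem X 1

theorem2p3p3 : (S : Set) (ar : S → ℕ) (X : ℕ → Bool) →
    ((t : Sig.Term S ar) → Sig._⪯_ S ar t (Sig.tlt S ar X t))
    × ((t t′ : Sig.Term S ar) → Sig._⪯_ S ar t t′ →
         Sig._⪯_ S ar (Sig.tlt S ar X t) (Sig.tlt S ar X t′))
    × ((t : Sig.Term S ar) → Sig.tlt S ar X (Sig.tlt S ar X t) ≡ Sig.tlt S ar X t)
theorem2p3p3 S ar X = ⪯-tlt S ar X , tlt-mono S ar X , tlt-idem S ar X
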